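{- Let $p$ be prime, $n\ge1$, $H_n$ a subgroup of $\mathrm{SL}_2(\mathbb{Z}/p^n\mathbb{Z})$, and for $1\le k\le n$ let $H_k$ be the image of $H_n$ in $\mathrm{SL}_2(\mathbb{Z}/p^k\mathbb{Z})$. Then reduction modulo $p^k$ of a representative induces a well-defined bijection $$I_k(\mathbb{Z}/p^n\mathbb{Z})\backslash\mathrm{SL}_2(\mathbb{Z}/p^n\mathbb{Z})/H_n\longrightarrow\Gamma_0(\mathbb{Z}/p^k\mathbb{Z})\backslash\mathrm{SL}_2(\mathbb{Z}/p^k\mathbb{Z})/H_k,$$ and these bijections commute with the maps $I_k(\mathbb{Z}/p^n\mathbb{Z})\backslash\mathrm{SL}_2(\mathbb{Z}/p^n\mathbb{Z})/H_n\to I_{k-1}(\mathbb{Z}/p^n\mathbb{Z})\backslash\mathrm{SL}_2(\mathbb{Z}/p^n\mathbb{Z})/H_n$ induced by the inclusion $I_k\subset I_{k-1}$ and the maps $\Gamma_0(\mathbb{Z}/p^k\mathbb{Z})\backslash\mathrm{SL}_2(\mathbb{Z}/p^k\mathbb{Z})/H_k\to\Gamma_0(\mathbb{Z}/p^{k-1}\mathbb{Z})\backslash\mathrm{SL}_2(\mathbb{Z}/p^{k-1}\mathbb{Z})/H_{k-1}$ induced by reduction (for $2\le k\le n$).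
   Context: For a ring $R$, $I_k(R)=\{\begin{pmatrix}a&b\\c&d\end{pmatrix}\in\mathrm{SL}_2(R): c\in p^kR\}$ (Hecke–Iwahori group of level $k$), and $\Gamma_0(R)$ is the subgroup of upper triangular matrices in $\mathrm{SL}_2(R)$. -}

module Defs where

open import Level using (0ℓ)
open import Data.Nat as ℕ using (ℕ; _≤_; _∸_)
open import Data.Integer using (ℤ; +_; _+_; _-_; _*_; -_)
open import Data.Integer.Divisibility using (_∣_)
open import Data.Product using (Σ; _×_; ∃; ∃-syntax)

-- Elements of ℤ/mℤ are represented by integers; equality in ℤ/mℤ is
-- congruence modulo m.  Reduction ℤ/p^n → ℤ/p^k (k ≤ n) is then the
-- identity on representatives, with the coarser equality.
infix 4 _≡[_]_ _≈[_]_
_≡[_]_ : ℤ → ℕ → ℤ → Set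
x ≡[ m ] y = (+ m) ∣ (x - y)

record M2 : Set where
  constructor mat
  field
    a b c d : ℤ
open M2 public

_·_ : M2 → M2 → M2
mat a₁ b₁ c₁ d₁ · mat a₂ b₂ c₂ d₂ =
  mat (a₁ * a₂ + b₁ * c₂) (a₁ * b₂ + b₁ * d₂)
      (c₁ * a₂ + d₁ * c₂) (c₁ * b₂ + d₁ * d₂)
infixl 7 _·_

I₂ : M2
I₂ = mat (+ 1) (+ 0) (+ 0) (+ 1)

det : M2 → ℤ
det (mat a b c d) = a * d - b * c

-- adjugate; this is the inverse of an element of SL₂(ℤ/m)
adj : M2 → M2
adj (mat a b c d) = mat d (- b) (- c) a

_≈[_]_ : M2 → ℕ → M2 → Set
g ≈[ m ] h = (a g ≡[ m ] a h) × (b g ≡[ m ] b h)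
           × (c g ≡[ m ] c h) × (d g ≡[ m ] d h)

SL2 : ℕ → M2 → Set
SL2 m g = det g ≡[ m ] + 1

record IsSubgroupSL (m : ℕ) (H : M2 → Set) : Set where
  field
    respects : ∀ {g h} → g ≈[ m ] h → H g → H h
    ⊆SL      : ∀ {g} → H g → SL2 m g
    one      : H I₂
    mulClosed : ∀ {g h} → H g → H h → H (g · h)
    invClosed : ∀ {g} → H g → H (adj g)

-- image of H (⊆ SL₂(ℤ/p^n)) in SL₂(ℤ/p^k) under reduction mod p^k
Img : ℕ → ℕ → (M2 → Set) → M2 → Set
Img p k H g = ∃[ h ] (H h × h ≈[ p ℕ.^ k ] g)

Iw : ℕ → ℕ → ℕ → M2 → Set
Iw p m k g = SL2 m g × ∃[ t ] (c g ≡[ m ] (+ (p ℕ.^ k) * t))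

Γ₀ : ℕ → M2 → Set
Γ₀ m g = SL2 m g × (c g ≡[ m ] + 0)

DC : ℕ → (M2 → Set) → (M2 → Set) → M2 → M2 → Set
DC m K H g g' = ∃[ x ] ∃[ y ] (K x × H y × (g' ≈[ m ] x · g · y))

module Submission where

-- Reduction mod pᵏ maps I_k(ℤ/pⁿ) into Γ₀(ℤ/pᵏ) and Hₙ into H_k, so it respects double cosets.
-- It is injective on them: if g' ≡ x g h (mod pᵏ) with x ∈ Γ₀ and h ∈ Hₙ, then x' = g' (g h)⁻¹
-- satisfies g' = x' g h in SL₂(ℤ/pⁿ) and x' ≡ x (mod pᵏ), so x' ∈ I_k.  It is surjective since
-- g ∈ SL₂(ℤ/pᵏ) lifts to SL₂(ℤ/pⁿ) once its first row is scaled by an inverse of det g modulo pⁿ,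
-- which exists because det g ≡ 1 (mod p).  All maps are the identity on representatives, so the
-- compatibility square commutes trivially.

open import Defs
open import Data.Nat as ℕ using (ℕ; zero; suc; _≤_; _^_; _∸_; z≤n; s≤s)
import Data.Nat.Properties as ℕₚ
import Data.Nat.Divisibility as ℕ∣
open import Data.Nat.Primality using (Prime)
open import Data.Integer using (ℤ; +_; _+_; _-_; _*_; -_; ∣_∣)
import Data.Integer.Properties as ℤₚ
import Data.Integer.Divisibility.Signed as Signed
open import Data.Integer.Tactic.RingSolver using (solve-∀)
open import Data.Product using (_×_; _,_; ∃-syntax; map₂)
open import Function using (id)
open import Relation.Binary.Bundles using (Setoid)
open import Relation.Binary.Structures using (IsEquivalence)
open import Relation.Binary.PropositionalEquality
open import Relation.Unary using (_⊆′_)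
import Relation.Binary.Reasoning.Setoid

^-monoʳ-∣ : ∀ p {j k} → j ≤ k → p ^ j ℕ∣.∣ p ^ k
^-monoʳ-∣ p {k = k} z≤n     = ℕ∣.1∣ (p ^ k)
^-monoʳ-∣ p         (s≤s j≤k) = ℕ∣.*-monoʳ-∣ p (^-monoʳ-∣ p j≤k)

m∣m^k : ∀ {m k} → 1 ≤ k → m ℕ∣.∣ m ^ k
m∣m^k {m} {suc k} (s≤s z≤n) = ℕ∣.m∣m*n (m ^ k)

-- A record around _≡[_]_, so that x and y can be inferred from the type.
infix 4 _≅[_]_
record _≅[_]_ (x : ℤ) (m : ℕ) (y : ℤ) : Set where
  constructor mk≅
  field unwrap : x ≡[ m ] y
open _≅[_]_ public

module _ {m : ℕ} where

  ≅-via : ∀ {x y e} → + m Signed.∣ e → e ≡ x - y → x ≅[ m ] y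
  ≅-via m∣e refl = mk≅ (Signed.∣⇒∣ᵤ m∣e)

  ∣-difference : ∀ {x y} → x ≅[ m ] y → + m Signed.∣ x - y
  ∣-difference (mk≅ m∣x-y) = Signed.∣ᵤ⇒∣ m∣x-y

  ≅-reflexive : ∀ {x y} → x ≡ y → x ≅[ m ] y
  ≅-reflexive {x} refl = ≅-via (Signed.divides (+ 0) refl) (sym (ℤₚ.+-inverseʳ x))

  ≅-refl : ∀ {x} → x ≅[ m ] x
  ≅-refl = ≅-reflexive refl

  ≅-sym : ∀ {x y} → x ≅[ m ] y → y ≅[ m ] x
  ≅-sym {x} {y} x≅y = ≅-via (Signed.∣m⇒∣-m (∣-difference x≅y)) (identity x y)
    where
    identity : ∀ x y → - (x - y) ≡ y - x
    identity = solve-∀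

  ≅-trans : ∀ {x y z} → x ≅[ m ] y → y ≅[ m ] z → x ≅[ m ] z
  ≅-trans {x} {y} {z} x≅y y≅z =
    ≅-via (Signed.∣m∣n⇒∣m+n (∣-difference x≅y) (∣-difference y≅z)) (identity x y z)
    where
    identity : ∀ x y z → (x - y) + (y - z) ≡ x - z
    identity = solve-∀

  +-cong : ∀ {x x' y y'} → x ≅[ m ] x' → y ≅[ m ] y' → x + y ≅[ m ] x' + y'
  +-cong {x} {x'} {y} {y'} x≅x' y≅y' =
    ≅-via (Signed.∣m∣n⇒∣m+n (∣-difference x≅x') (∣-difference y≅y')) (identity x x' y y')
    where
    identity : ∀ x x' y y' → (x - x') + (y - y') ≡ (x + y) - (x' + y')
    identity = solve-∀

  *-cong : ∀ {x x' y y'} → x ≅[ m ] x' → y ≅[ m ] y' → x * y ≅[ m ] x' * y'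
  *-cong {x} {x'} {y} {y'} x≅x' y≅y' =
    ≅-via (Signed.∣m∣n⇒∣m+n (Signed.∣n⇒∣m*n x (∣-difference y≅y'))
                            (Signed.∣m⇒∣m*n y' (∣-difference x≅x')))
          (identity x x' y y')
    where
    identity : ∀ x x' y y' → x * (y - y') + (x - x') * y' ≡ x * y - x' * y'
    identity = solve-∀

  multiple≅0 : ∀ t → + m * t ≅[ m ] + 0
  multiple≅0 t = ≅-via (Signed.divides t (identity (+ m) t)) refl
    where
    identity : ∀ m t → m * t - + 0 ≡ t * m
    identity = solve-∀

  ≅0⇒multiple : ∀ {x} → x ≅[ m ] + 0 → ∃[ t ] (x ≡ + m * t)
  ≅0⇒multiple {x} x≅0 with ∣-difference x≅0
  ... | Signed.divides t x-0≡t*m =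
    t , trans (sym (ℤₚ.+-identityʳ x)) (trans x-0≡t*m (ℤₚ.*-comm t (+ m)))

*-unit : ∀ {m s x} → s ≅[ m ] + 1 → s * x ≅[ m ] x
*-unit {x = x} s≅1 = ≅-trans (*-cong s≅1 ≅-refl) (≅-reflexive (ℤₚ.*-identityˡ x))

≅-∣ : ∀ {d m x y} → d ℕ∣.∣ m → x ≅[ m ] y → x ≅[ d ] y
≅-∣ d∣m (mk≅ m∣x-y) = mk≅ (ℕ∣.∣-trans d∣m m∣x-y)

infix 4 _≋[_]_
record _≋[_]_ (g : M2) (m : ℕ) (h : M2) : Set where
  constructor mk≋
  field
    ≋-a : a g ≅[ m ] a h
    ≋-b : b g ≅[ m ] b h
    ≋-c : c g ≅[ m ] c h
    ≋-d : d g ≅[ m ] d h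
open _≋[_]_ public

≋⇒≈ : ∀ {m g h} → g ≋[ m ] h → g ≈[ m ] h
≋⇒≈ (mk≋ (mk≅ ea) (mk≅ eb) (mk≅ ec) (mk≅ ed)) = ea , eb , ec , ed

≈⇒≋ : ∀ {m g h} → g ≈[ m ] h → g ≋[ m ] h
≈⇒≋ (ea , eb , ec , ed) = mk≋ (mk≅ ea) (mk≅ eb) (mk≅ ec) (mk≅ ed)

module _ {m : ℕ} where

  ≋-reflexive : ∀ {g h} → g ≡ h → g ≋[ m ] h
  ≋-reflexive refl = mk≋ ≅-refl ≅-refl ≅-refl ≅-refl

  ≋-sym : ∀ {g h} → g ≋[ m ] h → h ≋[ m ] g
  ≋-sym (mk≋ ea eb ec ed) = mk≋ (≅-sym ea) (≅-sym eb) (≅-sym ec) (≅-sym ed)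

  ≋-trans : ∀ {g h k} → g ≋[ m ] h → h ≋[ m ] k → g ≋[ m ] k
  ≋-trans (mk≋ ea eb ec ed) (mk≋ fa fb fc fd) =
    mk≋ (≅-trans ea fa) (≅-trans eb fb) (≅-trans ec fc) (≅-trans ed fd)

  ≋-isEquivalence : IsEquivalence (λ g h → g ≋[ m ] h)
  ≋-isEquivalence = record { refl = ≋-reflexive refl ; sym = ≋-sym ; trans = ≋-trans }

  ·-cong : ∀ {g g' h h'} → g ≋[ m ] g' → h ≋[ m ] h' → g · h ≋[ m ] g' · h'
  ·-cong {mat _ _ _ _} {mat _ _ _ _} {mat _ _ _ _} {mat _ _ _ _}
         (mk≋ a₁ b₁ c₁ d₁) (mk≋ a₂ b₂ c₂ d₂) =
    mk≋ (+-cong (*-cong a₁ a₂) (*-cong b₁ c₂)) (+-cong (*-cong a₁ b₂) (*-cong b₁ d₂))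
        (+-cong (*-cong c₁ a₂) (*-cong d₁ c₂)) (+-cong (*-cong c₁ b₂) (*-cong d₁ d₂))

  ·-congʳ : ∀ {g g'} h → g ≋[ m ] g' → g · h ≋[ m ] g' · h
  ·-congʳ h g≋g' = ·-cong g≋g' (≋-reflexive {g = h} refl)

  ·-congˡ : ∀ {h h'} g → h ≋[ m ] h' → g · h ≋[ m ] g · h'
  ·-congˡ g h≋h' = ·-cong (≋-reflexive {g = g} refl) h≋h'

≋-setoid : ℕ → Setoid _ _
≋-setoid m = record { isEquivalence = ≋-isEquivalence {m} }

module ≋-Reasoning (m : ℕ) = Relation.Binary.Reasoning.Setoid (≋-setoid m)

≋-∣ : ∀ {d m g h} → d ℕ∣.∣ m → g ≋[ m ] h → g ≋[ d ] h
≋-∣ d∣m (mk≋ ea eb ec ed) = mk≋ (≅-∣ d∣m ea) (≅-∣ d∣m eb) (≅-∣ d∣m ec) (≅-∣ d∣m ed)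

infixr 8 _⋆_
_⋆_ : ℤ → M2 → M2
s ⋆ mat a b c d = mat (s * a) (s * b) (s * c) (s * d)

⋆-unit : ∀ {m s g} → s ≅[ m ] + 1 → s ⋆ g ≋[ m ] g
⋆-unit {g = mat a b c d} s≅1 = mk≋ (*-unit s≅1) (*-unit s≅1) (*-unit s≅1) (*-unit s≅1)

mat-≡ : ∀ {a b c d a' b' c' d'} → a ≡ a' → b ≡ b' → c ≡ c' → d ≡ d' →
        mat a b c d ≡ mat a' b' c' d'
mat-≡ refl refl refl refl = refl

·-identityˡ : ∀ g → I₂ · g ≡ g
·-identityˡ (mat a b c d) = mat-≡ (top a c) (top b d) (bottom a c) (bottom b d)
  where
  top : ∀ x y → + 1 * x + + 0 * y ≡ x
  top = solve-∀
  bottom : ∀ x y → + 0 * x + + 1 * y ≡ y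
  bottom = solve-∀

·-identityʳ : ∀ g → g · I₂ ≡ g
·-identityʳ (mat a b c d) = mat-≡ (left a b) (right a b) (left c d) (right c d)
  where
  left : ∀ x y → x * + 1 + y * + 0 ≡ x
  left = solve-∀
  right : ∀ x y → x * + 0 + y * + 1 ≡ y
  right = solve-∀

·-assoc : ∀ f g h → f · g · h ≡ f · (g · h)
·-assoc (mat a b c d) (mat a' b' c' d') (mat a'' b'' c'' d'') =
  mat-≡ (entry a b a' b' c' d' a'' c'') (entry a b a' b' c' d' b'' d'')
        (entry c d a' b' c' d' a'' c'') (entry c d a' b' c' d' b'' d'')
  where
  entry : ∀ x₁ x₂ a b c d z₁ z₂ →
    (x₁ * a + x₂ * c) * z₁ + (x₁ * b + x₂ * d) * z₂ ≡
    x₁ * (a * z₁ + b * z₂) + x₂ * (c * z₁ + d * z₂)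
  entry = solve-∀

adj-cancelʳ : ∀ f g → f · adj g · g ≡ det g ⋆ f
adj-cancelʳ (mat x₁ x₂ x₃ x₄) (mat a b c d) =
  mat-≡ (left x₁ x₂ a b c d) (right x₁ x₂ a b c d)
        (left x₃ x₄ a b c d) (right x₃ x₄ a b c d)
  where
  left : ∀ x₁ x₂ a b c d →
    (x₁ * d + x₂ * - c) * a + (x₁ * - b + x₂ * a) * c ≡ (a * d - b * c) * x₁
  left = solve-∀
  right : ∀ x₁ x₂ a b c d →
    (x₁ * d + x₂ * - c) * b + (x₁ * - b + x₂ * a) * d ≡ (a * d - b * c) * x₂
  right = solve-∀

·-adj-cancelʳ : ∀ f g → f · g · adj g ≡ det g ⋆ f
·-adj-cancelʳ (mat x₁ x₂ x₃ x₄) (mat a b c d) =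
  mat-≡ (left x₁ x₂ a b c d) (right x₁ x₂ a b c d)
        (left x₃ x₄ a b c d) (right x₃ x₄ a b c d)
  where
  left : ∀ x₁ x₂ a b c d →
    (x₁ * a + x₂ * c) * d + (x₁ * b + x₂ * d) * - c ≡ (a * d - b * c) * x₁
  left = solve-∀
  right : ∀ x₁ x₂ a b c d →
    (x₁ * a + x₂ * c) * - b + (x₁ * b + x₂ * d) * a ≡ (a * d - b * c) * x₂
  right = solve-∀

det-· : ∀ f g → det (f · g) ≡ det f * det g
det-· (mat a b c d) (mat a' b' c' d') = identity a b c d a' b' c' d'
  where
  identity : ∀ a b c d a' b' c' d' →
    (a * a' + b * c') * (c * b' + d * d') - (a * b' + b * d') * (c * a' + d * c') ≡
    (a * d - b * c) * (a' * d' - b' * c')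
  identity = solve-∀

det-adj : ∀ g → det (adj g) ≡ det g
det-adj (mat a b c d) = identity a b c d
  where
  identity : ∀ a b c d → d * a - (- b) * (- c) ≡ a * d - b * c
  identity = solve-∀

-- For x = 1 + q this is 1 - q + q² - ⋯ ± qⁿ, an inverse of x modulo qⁿ⁺¹.
unitInverse : ℕ → ℤ → ℤ
unitInverse zero    x = + 1
unitInverse (suc n) x = + 1 - (x - + 1) * unitInverse n x

-- x ≡[ m ] + 1 unfolds to m ∣ ∣ x - + 1 ∣ in ℕ, the form the divisibility chains below use.
unitInverse-inverse : ∀ {m x} n → x ≡[ m ] + 1 → x * unitInverse n x ≡[ m ^ n ] + 1
unitInverse-inverse {m} {x} zero    _      = ℕ∣.1∣ _
unitInverse-inverse {m} {x} (suc n) m∣x-1 = begin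
  m ℕ.* m ^ n                       ∣⟨ ℕ∣.*-pres-∣ m∣x-1 (unitInverse-inverse {x = x} n m∣x-1) ⟩
  ∣ x - + 1 ∣ ℕ.* ∣ e ∣             ≡⟨ ℤₚ.abs-* (x - + 1) e ⟨
  ∣ (x - + 1) * e ∣                 ≡⟨ ℤₚ.∣-i∣≡∣i∣ ((x - + 1) * e) ⟨
  ∣ - ((x - + 1) * e) ∣             ≡⟨ cong ∣_∣ (identity x (unitInverse n x)) ⟩
  ∣ x * unitInverse (suc n) x - + 1 ∣ ∎
  where
  open ℕ∣.∣-Reasoning
  e = x * unitInverse n x - + 1
  identity : ∀ x r → - ((x - + 1) * (x * r - + 1)) ≡ x * (+ 1 - (x - + 1) * r) - + 1
  identity = solve-∀

unitInverse≡1 : ∀ {m x} n → x ≡[ m ] + 1 → unitInverse n x ≡[ m ] + 1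
unitInverse≡1         zero    _      = ℕ∣._∣0 _
unitInverse≡1 {m} {x} (suc n) m∣x-1 = begin
  m                                 ∣⟨ ℕ∣.∣m⇒∣m*n ∣ r ∣ m∣x-1 ⟩
  ∣ x - + 1 ∣ ℕ.* ∣ r ∣             ≡⟨ ℤₚ.abs-* (x - + 1) r ⟨
  ∣ (x - + 1) * r ∣                 ≡⟨ ℤₚ.∣-i∣≡∣i∣ ((x - + 1) * r) ⟨
  ∣ - ((x - + 1) * r) ∣             ≡⟨ cong ∣_∣ (identity x r) ⟩
  ∣ unitInverse (suc n) x - + 1 ∣   ∎
  where
  open ℕ∣.∣-Reasoning
  r = unitInverse n x
  identity : ∀ x r → - ((x - + 1) * r) ≡ (+ 1 - (x - + 1) * r) - + 1
  identity = solve-∀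

scaleRow₁ : ℤ → M2 → M2
scaleRow₁ u (mat a b c d) = mat (u * a) (u * b) c d

det-scaleRow₁ : ∀ u g → det (scaleRow₁ u g) ≡ det g * u
det-scaleRow₁ u (mat a b c d) = identity u a b c d
  where
  identity : ∀ u a b c d → (u * a) * d - (u * b) * c ≡ (a * d - b * c) * u
  identity = solve-∀

SL2-lift : ∀ {m d} n g → m ℕ∣.∣ d → SL2 d g → ∃[ g' ] (SL2 (m ^ n) g' × g' ≋[ d ] g)
SL2-lift {d = d} n g@(mat _ _ _ _) m∣d det≡1 =
  scaleRow₁ u g ,
  subst (_≡[ _ ] + 1) (sym (det-scaleRow₁ u g))
        (unitInverse-inverse {x = det g} n (ℕ∣.∣-trans m∣d det≡1)) ,
  mk≋ (*-unit u≅1) (*-unit u≅1) ≅-refl ≅-refl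
  where
  u = unitInverse n (det g)
  u≅1 : u ≅[ d ] + 1
  u≅1 = mk≅ (unitInverse≡1 n det≡1)

SL2⇒det≅1 : ∀ {m} g → SL2 m g → det g ≅[ m ] + 1
SL2⇒det≅1 g = mk≅

Γ₀-I₂ : ∀ {m} → Γ₀ m I₂
Γ₀-I₂ = unwrap (≅-refl {x = + 1}) , unwrap (≅-refl {x = + 0})

Γ₀-∣ : ∀ {d m} → d ℕ∣.∣ m → Γ₀ m ⊆′ Γ₀ d
Γ₀-∣ d∣m _ (det≡1 , c≡0) = ℕ∣.∣-trans d∣m det≡1 , ℕ∣.∣-trans d∣m c≡0

DC-mono : ∀ {d m} {K K' H H' : M2 → Set} {g g'} → d ℕ∣.∣ m → K ⊆′ K' → H ⊆′ H' →
          DC m K H g g' → DC d K' H' g g'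
DC-mono {g = g} {g'} d∣m K⊆K' H⊆H' (x , y , x∈K , y∈H , g'≈xgy) =
  x , y , K⊆K' x x∈K , H⊆H' y y∈H , ≋⇒≈ (≋-∣ d∣m (≈⇒≋ {g = g'} {x · g · y} g'≈xgy))

≋⇒DC : ∀ {m} {K H : M2 → Set} {g g'} → K I₂ → H I₂ → g ≋[ m ] g' → DC m K H g g'
≋⇒DC {m} {g = g} {g'} I₂∈K I₂∈H g≋g' = I₂ , I₂ , I₂∈K , I₂∈H , ≋⇒≈ g'≋I₂gI₂
  where
  open ≋-Reasoning m
  g'≋I₂gI₂ : g' ≋[ m ] I₂ · g · I₂
  g'≋I₂gI₂ = begin
    g'           ≈⟨ g≋g' ⟨
    g            ≡⟨ ·-identityˡ g ⟨
    I₂ · g       ≡⟨ ·-identityʳ (I₂ · g) ⟨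
    I₂ · g · I₂  ∎

module _ (p : ℕ) where

  Iw⇒Γ₀ : ∀ {M} k → p ^ k ℕ∣.∣ M → Iw p M k ⊆′ Γ₀ (p ^ k)
  Iw⇒Γ₀ k pᵏ∣M x (det≡1 , t , c≡pᵏt) =
    ℕ∣.∣-trans pᵏ∣M det≡1 ,
    unwrap (≅-trans (≅-∣ pᵏ∣M (mk≅ {c x} {y = + (p ^ k) * t} c≡pᵏt))
                    (multiple≅0 t))

  Iw-antitone : ∀ {M j k} → j ≤ k → Iw p M k ⊆′ Iw p M j
  Iw-antitone {M} {j} {k} j≤k x (det≡1 , t , c≡pᵏt) with ^-monoʳ-∣ p j≤k
  ... | ℕ∣.divides q pᵏ≡q*pʲ = det≡1 , + q * t , subst (c x ≡[ M ]_) pᵏt≡pʲqt c≡pᵏt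
    where
    open ≡-Reasoning
    identity : ∀ q r t → (q * r) * t ≡ r * (q * t)
    identity = solve-∀
    pᵏt≡pʲqt : + (p ^ k) * t ≡ + (p ^ j) * (+ q * t)
    pᵏt≡pʲqt = begin
      + (p ^ k) * t             ≡⟨ cong (λ z → + z * t) pᵏ≡q*pʲ ⟩
      + (q ℕ.* p ^ j) * t       ≡⟨ cong (_* t) (ℤₚ.pos-* q (p ^ j)) ⟩
      (+ q * + (p ^ j)) * t     ≡⟨ identity (+ q) (+ (p ^ j)) t ⟩
      + (p ^ j) * (+ q * t)     ∎

  ≋Γ₀⇒Iw : ∀ {M k x x'} → SL2 M x' → x' ≋[ p ^ k ] x → Γ₀ (p ^ k) x → Iw p M k x'
  ≋Γ₀⇒Iw {M} det≡1 x'≋x (_ , c≡0)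
    with ≅0⇒multiple (≅-trans (≋-c x'≋x) (mk≅ {y = + 0} c≡0))
  ... | t , c≡pᵏt = det≡1 , t , unwrap (≅-reflexive {M} c≡pᵏt)

  ⊆Img : ∀ {H} k → H ⊆′ Img p k H
  ⊆Img k g g∈H = g , g∈H , ≋⇒≈ (≋-reflexive {g = g} refl)

  Img-antitone : ∀ {H j k} → j ≤ k → Img p k H ⊆′ Img p j H
  Img-antitone j≤k g (h , h∈H , h≈g) =
    h , h∈H , ≋⇒≈ (≋-∣ (^-monoʳ-∣ p j≤k) (≈⇒≋ {g = h} {g} h≈g))

module _ {M : ℕ} {H : M2 → Set} (H-subgroup : IsSubgroupSL M H) where
  open IsSubgroupSL H-subgroup

  DC-Γ₀⇒DC-Iw : ∀ {p k g g'} → p ^ k ℕ∣.∣ M → SL2 M g → SL2 M g' →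
                DC (p ^ k) (Γ₀ (p ^ k)) (Img p k H) g g' → DC M (Iw p M k) H g g'
  DC-Γ₀⇒DC-Iw {p} {k} {g} {g'} pᵏ∣M det-g≡1 det-g'≡1
              (x , y , x∈Γ₀ , (h , h∈H , h≈y) , g'≈xgy) =
    x' , h , ≋Γ₀⇒Iw p {M} {k} {x} det-x'≡1 x'≋x x∈Γ₀ , h∈H , ≋⇒≈ g'≋x'gh
    where
    gh = g · h
    x' = g' · adj gh

    det-gh≅1 : det gh ≅[ M ] + 1
    det-gh≅1 = ≅-trans (≅-reflexive (det-· g h))
                       (*-cong (SL2⇒det≅1 g det-g≡1) (SL2⇒det≅1 h (⊆SL h∈H)))

    det-x'≡1 : SL2 M x'
    det-x'≡1 = unwrap (≅-trans (≅-reflexive det-x'≡det-g'*det-gh)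
                               (*-cong (SL2⇒det≅1 g' det-g'≡1) det-gh≅1))
      where
      det-x'≡det-g'*det-gh : det x' ≡ det g' * det gh
      det-x'≡det-g'*det-gh = trans (det-· g' (adj gh)) (cong (det g' *_) (det-adj gh))

    g'≋x'gh : g' ≋[ M ] x' · g · h
    g'≋x'gh = begin
      g'             ≈⟨ ⋆-unit det-gh≅1 ⟨
      det gh ⋆ g'    ≡⟨ adj-cancelʳ g' gh ⟨
      x' · gh        ≡⟨ ·-assoc x' g h ⟨
      x' · g · h     ∎
      where open ≋-Reasoning M

    x'≋x : x' ≋[ p ^ k ] x
    x'≋x = begin
      g' · adj gh         ≈⟨ ·-congʳ (adj gh) (≈⇒≋ {g = g'} {x · g · y} g'≈xgy) ⟩
      x · g · y · adj gh  ≈⟨ ·-congʳ (adj gh) (·-congˡ (x · g) (≈⇒≋ {g = h} {y} h≈y)) ⟨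
      x · g · h · adj gh  ≡⟨ cong (_· adj gh) (·-assoc x g h) ⟩
      x · gh · adj gh     ≡⟨ ·-adj-cancelʳ x gh ⟩
      det gh ⋆ x          ≈⟨ ⋆-unit (≅-∣ pᵏ∣M det-gh≅1) ⟩
      x                   ∎
      where open ≋-Reasoning (p ^ k)

lemma4p7 : (p : ℕ) → Prime p → (n : ℕ) → 1 ≤ n →
    (H : M2 → Set) → IsSubgroupSL (p ^ n) H →
    (∀ k → 1 ≤ k → k ≤ n →
      (∀ g g' → SL2 (p ^ n) g → SL2 (p ^ n) g' →
        DC (p ^ n) (Iw p (p ^ n) k) H g g' →
        DC (p ^ k) (Γ₀ (p ^ k)) (Img p k H) g g')
      × (∀ g g' → SL2 (p ^ n) g → SL2 (p ^ n) g' →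
        DC (p ^ k) (Γ₀ (p ^ k)) (Img p k H) g g' →
        DC (p ^ n) (Iw p (p ^ n) k) H g g')
      × (∀ g → SL2 (p ^ k) g →
        ∃[ g' ] (SL2 (p ^ n) g' × DC (p ^ k) (Γ₀ (p ^ k)) (Img p k H) g' g)))
    × (∀ k → 2 ≤ k → k ≤ n →
      (∀ g g' → SL2 (p ^ n) g → SL2 (p ^ n) g' →
        DC (p ^ n) (Iw p (p ^ n) k) H g g' →
        DC (p ^ n) (Iw p (p ^ n) (k ∸ 1)) H g g')
      × (∀ g g' → SL2 (p ^ k) g → SL2 (p ^ k) g' →
        DC (p ^ k) (Γ₀ (p ^ k)) (Img p k H) g g' →
        DC (p ^ (k ∸ 1)) (Γ₀ (p ^ (k ∸ 1))) (Img p (k ∸ 1) H) g g')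
      × (∀ g → SL2 (p ^ n) g →
        DC (p ^ (k ∸ 1)) (Γ₀ (p ^ (k ∸ 1))) (Img p (k ∸ 1) H) g g))
lemma4p7 p _ n _ H H-subgroup =
  (λ k 1≤k k≤n → let pᵏ∣pⁿ = ^-monoʳ-∣ p k≤n in
      (λ g g' _ _ → DC-mono {g = g} {g'} pᵏ∣pⁿ (Iw⇒Γ₀ p k pᵏ∣pⁿ) (⊆Img p k))
    , (λ g g' → DC-Γ₀⇒DC-Iw H-subgroup {p} {k} {g} {g'} pᵏ∣pⁿ)
    , (λ g det≡1 → map₂ (map₂ (≋⇒DC Γ₀-I₂ (⊆Img p k I₂ one)))
                        (SL2-lift n g (m∣m^k 1≤k) det≡1)))
  , (λ k 2≤k k≤n → let pᵏ⁻¹∣pᵏ = ^-monoʳ-∣ p (pred≤ k) in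
      (λ g g' _ _ → DC-mono {g = g} {g'} ℕ∣.∣-refl (Iw-antitone p (pred≤ k)) (λ _ → id))
    , (λ g g' _ _ → DC-mono {g = g} {g'} pᵏ⁻¹∣pᵏ (Γ₀-∣ pᵏ⁻¹∣pᵏ) (Img-antitone p (pred≤ k)))
    , (λ g _ → ≋⇒DC Γ₀-I₂ (⊆Img p (k ∸ 1) I₂ one) (≋-reflexive {g = g} refl)))
  where
  open IsSubgroupSL H-subgroup using (one)
  pred≤ : ∀ k → k ∸ 1 ≤ k
  pred≤ k = ℕₚ.m∸n≤m k 1
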